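{- Let $G$ be a finite digraph with inner diameter $d(G)$, and let $LG$ be its line digraph with inner diameter $d(LG)$. Then $$d(G)-1\le d(LG)\le d(G)+1.$$
   Context: A digraph $G=(V,E)$ has a finite vertex set and a finite multiset of arcs (loops and multiple arcs allowed); $G$ need not be strongly connected. $\mathrm{dist}_G(u,v)$ is the length of a shortest directed path from $u$ to $v$ ($\infty$ if none). The inner diameter is $d(G)=\max_{u,v\in V}\{\mathrm{dist}_G(u,v):\mathrm{dist}_G(u,v)<\infty\}$. The line digraph $LG$ has one vertex for each arc of $G$, with an arc from the vertex of arc $(u,v)$ to the vertex of arc $(w,z)$ if and only if $v=w$. -}

module Defs where

open import Data.Nat using (ℕ; zero; suc; _≤_; _<_)
open import Data.Fin using (Fin; _≟_)
open import Data.List using (List; length; lookup; filter; cartesianProduct; allFin)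
open import Data.List.Membership.Propositional using (_∈_)
open import Data.Product using (_×_; _,_; proj₁; proj₂; ∃; ∃-syntax)
open import Data.Sum using (_⊎_)
open import Relation.Binary.PropositionalEquality using (_≡_)
open import Relation.Nullary using (¬_)

-- A finite digraph: vertex set Fin n, and a finite multiset of arcs
-- (given as a list of (tail , head) pairs; loops and repeated arcs allowed).
record Digraph : Set where
  field
    n    : ℕ
    arcs : List (Fin n × Fin n)

open Digraph public

V : Digraph → Set
V G = Fin (n G)

Adj : (G : Digraph) → V G → V G → Set
Adj G u w = (u , w) ∈ arcs G

data Walk (G : Digraph) : V G → V G → ℕ → Set where
  nil  : ∀ {u} → Walk G u u 0
  cons : ∀ {u w v k} → Adj G u w → Walk G w v k → Walk G u v (suc k)

Dist : (G : Digraph) → V G → V G → ℕ → Set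
Dist G u v k = Walk G u v k × (∀ j → j < k → ¬ Walk G u v j)

-- D is the inner diameter of G: the maximum of all finite distances
-- (with the convention max ∅ = 0 when G has no vertices).
InnerDiam : Digraph → ℕ → Set
InnerDiam G D =
  (∀ u v k → Dist G u v k → k ≤ D) ×
  ((D ≡ 0) ⊎ (∃[ u ] ∃[ v ] Dist G u v D))

-- Line digraph: one vertex per arc of G (arc i = lookup (arcs G) i), and an
-- arc from i to j iff head of arc i = tail of arc j.
L : Digraph → Digraph
L G = record
  { n    = length (arcs G)
  ; arcs = filter (λ p → proj₂ (lookup (arcs G) (proj₁ p)) ≟ proj₁ (lookup (arcs G) (proj₂ p)))
                  (cartesianProduct (allFin (length (arcs G))) (allFin (length (arcs G))))
  }

{-# OPTIONS --safe #-}
module Submission where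

-- A walk a₀ a₁ … aₖ in LG is a sequence of consecutive arcs of G. Dropping the
-- first tail and the last head leaves a walk of length k − 1 in G from the head
-- of a₀ to the tail of aₖ; keeping them gives one of length k + 1 from the tail
-- of a₀ to the head of aₖ. Both constructions can be reversed, so
-- dist_LG(a, b) ≤ dist_G(head a, tail b) + 1 ≤ d(G) + 1, and a shortest walk
-- u … v of length d(G) in G, seen from its first arc to its last, gives
-- d(G) − 1 ≤ dist_LG(first, last) ≤ d(LG).

open import Defs
open import Data.Nat using (ℕ; zero; suc; _≤_; _<_; _∸_; _+_; z≤n; s≤s; s≤s⁻¹; _≤?_)
open import Data.Nat.Properties using (≤-trans; ≤-reflexive; +-comm; ≮⇒≥)
open import Data.Nat.Induction using (<-rec)
open import Data.Fin using (_≟_)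
open import Data.List using (length; lookup; cartesianProduct; allFin)
open import Data.List.Membership.Propositional.Properties
  using (∈-filter⁺; ∈-filter⁻; ∈-cartesianProduct⁺; ∈-allFin; ∈-lookup)
open import Data.List.Relation.Unary.Any using (index)
open import Data.List.Relation.Unary.Any.Properties using (lookup-index)
open import Data.Product using (_×_; _,_; proj₁; proj₂; ∃; ∃-syntax)
open import Data.Sum using (_⊎_; inj₁; inj₂)
open import Relation.Binary.PropositionalEquality using (_≡_; refl; sym; trans; cong; subst)
open import Function using (_∘_)
open import Relation.Nullary using (¬_)
open import Relation.Nullary.Negation using (¬¬-map)
open import Relation.Nullary.Decidable using (decidable-stable)

-- Existence of a walk of given length is not decided here, so shortest walks are
-- only obtained under ¬¬; every goal they serve is a decidable, hence ¬¬-stable,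
-- inequality on ℕ.
¬¬-least : {P : ℕ → Set} {k : ℕ} → P k → ¬ ¬ (∃[ j ] (P j × (∀ i → i < j → ¬ P i)))
¬¬-least {P} {k} pk noLeast = nowhere k pk
  where
  nowhere : ∀ i → ¬ P i
  nowhere = <-rec (λ i → ¬ P i) λ i below pi → noLeast (i , pi , λ h h<i → below h<i)

DistancesBoundedBy : Digraph → ℕ → Set
DistancesBoundedBy G D = ∀ u v k → Dist G u v k → k ≤ D

Arc : Digraph → Set
Arc G = V (L G)

module _ {G : Digraph} where

  ¬¬-shortest : ∀ {u v k} → Walk G u v k → ¬ ¬ ∃ (Dist G u v)
  ¬¬-shortest = ¬¬-least

  Dist-≤-Walk : ∀ {u v k j} → Dist G u v k → Walk G u v j → k ≤ j
  Dist-≤-Walk (_ , shorter-absent) w = ≮⇒≥ (λ j<k → shorter-absent _ j<k w)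

module _ {G : Digraph} where

  tail head : Arc G → V G
  tail a = proj₁ (lookup (arcs G) a)
  head a = proj₂ (lookup (arcs G) a)

  arc : (a : Arc G) → Adj G (tail a) (head a)
  arc = ∈-lookup

  tail-index : ∀ {u v} (e : Adj G u v) → tail (index e) ≡ u
  tail-index e = sym (cong proj₁ (lookup-index e))

  head-index : ∀ {u v} (e : Adj G u v) → head (index e) ≡ v
  head-index e = sym (cong proj₂ (lookup-index e))

  Adj-L⁺ : ∀ {a b} → head a ≡ tail b → Adj (L G) a b
  Adj-L⁺ {a} {b} = ∈-filter⁺ (λ p → head (proj₁ p) ≟ tail (proj₂ p))
    (∈-cartesianProduct⁺ (∈-allFin a) (∈-allFin b))

  Adj-L⁻ : ∀ {a b} → Adj (L G) a b → head a ≡ tail b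
  Adj-L⁻ = proj₂ ∘ ∈-filter⁻ (λ p → head (proj₁ p) ≟ tail (proj₂ p))
    {xs = cartesianProduct (allFin (length (arcs G))) (allFin (length (arcs G)))}

  map-tail : ∀ {a b k} → Walk (L G) a b k → Walk G (tail a) (tail b) k
  map-tail nil                = nil
  map-tail (cons {u = a} e w) = cons (arc a) (subst (λ x → Walk G x _ _) (sym (Adj-L⁻ e)) (map-tail w))

  map-head : ∀ {a b k} → Walk (L G) a b k → Walk G (head a) (head b) k
  map-head nil                = nil
  map-head (cons {w = c} e w) = cons (subst (λ x → Adj G x (head c)) (sym (Adj-L⁻ e)) (arc c)) (map-head w)

  Walk-L⇒inner-Walk : ∀ {a b k} → Walk (L G) a b (suc k) → Walk G (head a) (tail b) k
  Walk-L⇒inner-Walk (cons e w) = subst (λ x → Walk G x _ _) (sym (Adj-L⁻ e)) (map-tail w)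

  Walk-L⇒outer-Walk : ∀ {a b k} → Walk (L G) a b k → Walk G (tail a) (head b) (suc k)
  Walk-L⇒outer-Walk {a} w = cons (arc a) (map-head w)

  inner-Walk⇒Walk-L : ∀ {a b x k} → head a ≡ x → Walk G x (tail b) k → Walk (L G) a b (suc k)
  inner-Walk⇒Walk-L head≡x nil        = cons (Adj-L⁺ head≡x) nil
  inner-Walk⇒Walk-L head≡x (cons e w) =
    cons (Adj-L⁺ (trans head≡x (sym (tail-index e)))) (inner-Walk⇒Walk-L (head-index e) w)

  outer-Walk⇒Walk-L : ∀ {u v k} → Walk G u v (suc k) →
                      ∃[ a ] ∃[ b ] (tail a ≡ u × head b ≡ v × Walk (L G) a b k)
  outer-Walk⇒Walk-L (cons e nil) = index e , index e , tail-index e , head-index e , nil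
  outer-Walk⇒Walk-L (cons e w@(cons _ _)) with outer-Walk⇒Walk-L w
  ... | a , b , refl , refl , wᴸ = index e , b , tail-index e , refl , cons (Adj-L⁺ (head-index e)) wᴸ

  Dist-L-≤ : ∀ {d a b k} → DistancesBoundedBy G d → Dist (L G) a b k → k ≤ suc d
  Dist-L-≤ {k = zero} _ _ = z≤n
  Dist-L-≤ {d} {k = suc k} bounded distᴸ@(wᴸ , _) =
    decidable-stable (suc k ≤? suc d) (¬¬-map via-shortest (¬¬-shortest (Walk-L⇒inner-Walk wᴸ)))
    where
    via-shortest : ∃ (Dist G (head _) (tail _)) → suc k ≤ suc d
    via-shortest (j , dist) =
      ≤-trans (Dist-≤-Walk distᴸ (inner-Walk⇒Walk-L refl (proj₁ dist))) (s≤s (bounded _ _ j dist))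

  Dist-∸1-≤ : ∀ {dᴸ u v k} → DistancesBoundedBy (L G) dᴸ → Dist G u v k → k ∸ 1 ≤ dᴸ
  Dist-∸1-≤ {k = zero} _ _ = z≤n
  Dist-∸1-≤ {dᴸ} {k = suc k} boundedᴸ dist@(w , _) with outer-Walk⇒Walk-L w
  ... | a , b , refl , refl , wᴸ = decidable-stable (k ≤? dᴸ) (¬¬-map via-shortest (¬¬-shortest wᴸ))
    where
    via-shortest : ∃ (Dist (L G) a b) → k ≤ dᴸ
    via-shortest (j , distᴸ) =
      ≤-trans (s≤s⁻¹ (Dist-≤-Walk dist (Walk-L⇒outer-Walk (proj₁ distᴸ)))) (boundedᴸ a b j distᴸ)

proposition2 : (G : Digraph) (d dL : ℕ) → InnerDiam G d → InnerDiam (L G) dL →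
    (d ∸ 1 ≤ dL) × (dL ≤ d + 1)
proposition2 G d dL (bounded , attained) (boundedᴸ , attainedᴸ) = lower attained , upper attainedᴸ
  where
  lower : (d ≡ 0) ⊎ (∃[ u ] ∃[ v ] Dist G u v d) → d ∸ 1 ≤ dL
  lower (inj₁ refl)           = z≤n
  lower (inj₂ (_ , _ , dist)) = Dist-∸1-≤ boundedᴸ dist

  upper : (dL ≡ 0) ⊎ (∃[ a ] ∃[ b ] Dist (L G) a b dL) → dL ≤ d + 1
  upper (inj₁ refl)            = z≤n
  upper (inj₂ (_ , _ , distᴸ)) = ≤-trans (Dist-L-≤ bounded distᴸ) (≤-reflexive (+-comm 1 d))
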